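{- Let $\tau=(w,x)$ be a pair, $t=t_{i_1,i_2}\in R_\tau$, $p=(i,j)\in X^c_{\tau_t}$ and $q=p^\uparrow_{\tau_t}=(i',j)$. Assume that $q\in X^c_{(xt,x)}$ and that $p^\leftarrow_\tau=(i,j')$ with $j'\ge x(i_1)$. Then $q$ is $\uparrow$-maximal with respect to $\tau$.
   Context: $S_n$ is the symmetric group on $\{1,\dots,n\}$ with Bruhat order $\le$; $\Box=\{0,\dots,n\}^2$. For $w\in S_n$, $\mathrm{rk}_w(i,j)=\#\{u\le i:w(u)\le j\}$ on $\Box$, and $D_w((i,j),(i',j'))=\mathrm{rk}_w(i,j)+\mathrm{rk}_w(i',j')-\mathrm{rk}_w(i,j')-\mathrm{rk}_w(i',j)$. A pair is $\sigma=(u,v)$ with $v\le u$; $\mathrm{rk}_\sigma=\mathrm{rk}_v-\mathrm{rk}_u$, $X_\sigma=\{p\in\Box:\mathrm{rk}_\sigma(p)=0\}$, $X^c_\sigma=\Box\setminus X_\sigma$. For $\tau=(w,x)$, $R_\tau=\{t\text{ transposition}:x<xt\le w\}$, $t_{i_1,i_2}$ ($i_1<i_2$) is a transposition, and for $t\in R_\tau$ the pairs $\tau_t=(w,xt)$ and $(xt,x)$ are defined. For a pair $\sigma=(u,v)$ and $p=(i,j)\in\Box$ with $1\le j\le n-1$: $j^-=\max\{k<j:(i,k)\in X_\sigma\}$, $p^\leftarrow_\sigma=(i,j^-)$, $i^-=\min\{l\le i:(l,j^-)\in X_\sigma,\ D_u(p,(l,j^-))=0\}$, $p^\uparrow_\sigma=(i^-,j)$;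 $p$ is $\uparrow$-maximal w.r.t. $\sigma$ if $p^\uparrow_\sigma=p$. -}

module Defs where

open import Data.Nat using (ℕ; zero; suc; _+_; _<_; _≤_; _<?_; _≟_)
open import Data.Fin using (Fin; toℕ)
open import Data.Fin.Permutation using (Permutation′; _⟨$⟩ʳ_; _∘ₚ_; transpose)
open import Data.List using (List; length; filter; allFin; concatMap; map)
open import Data.Product using (_×_; _,_; Σ; ∃; proj₁; proj₂)
open import Relation.Nullary using (Dec; yes; no; ¬_)
open import Relation.Nullary.Decidable using (_×-dec_)
open import Relation.Binary.PropositionalEquality using (_≡_; _≢_)
open import Relation.Binary.Construct.Closure.ReflexiveTransitive using (Star)

-- Permutations of {1,…,n}; the value k ∈ {1,…,n} is represented by
-- the element k-1 of Fin n.
Perm : ℕ → Set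
Perm n = Permutation′ n

-- Transposition t_{a,b} and right multiplication: (x t)(k) = x(t(k)).
_·t[_,_] : ∀ {n} → Perm n → Fin n → Fin n → Perm n
x ·t[ a , b ] = transpose a b ∘ₚ x

inversions : ∀ {n} → Perm n → ℕ
inversions {n} w =
  length (filter (λ ab → (toℕ (proj₁ ab) <? toℕ (proj₂ ab))
                          ×-dec (toℕ (w ⟨$⟩ʳ proj₂ ab) <? toℕ (w ⟨$⟩ʳ proj₁ ab)))
                 (concatMap (λ a → map (λ b → (a , b)) (allFin n)) (allFin n)))

BruhatStep : ∀ {n} → Perm n → Perm n → Set
BruhatStep {n} x y =
  Σ (Fin n) λ a → Σ (Fin n) λ b →
    (toℕ a < toℕ b) × ((∀ k → y ⟨$⟩ʳ k ≡ (x ·t[ a , b ]) ⟨$⟩ʳ k))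
                    × (inversions x < inversions y)

_≤B_ : ∀ {n} → Perm n → Perm n → Set
_≤B_ = Star BruhatStep

_<B_ : ∀ {n} → Perm n → Perm n → Set
x <B y = (x ≤B y) × ¬ (∀ k → x ⟨$⟩ʳ k ≡ y ⟨$⟩ʳ k)

-- Rank function on □ = {0,…,n}²:
-- rk_w(i,j) = #{u ≤ i : w(u) ≤ j}  (1-based u, w(u)).

rk : ∀ {n} → Perm n → ℕ → ℕ → ℕ
rk {n} w i j =
  length (filter (λ u → (toℕ u <? i) ×-dec (toℕ (w ⟨$⟩ʳ u) <? j)) (allFin n))

-- D_w((i,j),(i',j')) = 0, stated without subtraction:
-- rk(i,j) + rk(i',j') = rk(i,j') + rk(i',j)
D≡0 : ∀ {n} → Perm n → ℕ × ℕ → ℕ × ℕ → Set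
D≡0 w (i , j) (i' , j') = rk w i j + rk w i' j' ≡ rk w i j' + rk w i' j

record Pair (n : ℕ) : Set where
  constructor pair
  field
    up   : Perm n
    down : Perm n
    down≤up : down ≤B up
open Pair public

InBox : ℕ → ℕ × ℕ → Set
InBox n (i , j) = (i ≤ n) × (j ≤ n)

-- p ∈ X_σ  iff  rk_σ(p) = rk_v(p) - rk_u(p) = 0
InX : ∀ {n} → Pair n → ℕ × ℕ → Set
InX σ (i , j) = rk (down σ) i j ≡ rk (up σ) i j

InXc : ∀ {n} → Pair n → ℕ × ℕ → Set
InXc σ p = ¬ InX σ p

InX? : ∀ {n} (σ : Pair n) p → Dec (InX σ p)
InX? σ (i , j) = rk (down σ) i j ≟ rk (up σ) i j

D≡0? : ∀ {n} (w : Perm n) p q → Dec (D≡0 w p q)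
D≡0? w (i , j) (i' , j') = (rk w i j + rk w i' j') ≟ (rk w i j' + rk w i' j)

-- largest k < j with P k   (0 if there is none)
maxBelow : (P : ℕ → Set) → (∀ k → Dec (P k)) → ℕ → ℕ
maxBelow P d zero = 0
maxBelow P d (suc k) with d k
... | yes _ = k
... | no  _ = maxBelow P d k

-- smallest l ≤ i with P l   (i if there is none)
minUpTo : (P : ℕ → Set) → (∀ k → Dec (P k)) → ℕ → ℕ
minUpTo P d zero = 0
minUpTo P d (suc i) with d 0
... | yes _ = 0
... | no  _ = suc (minUpTo (λ l → P (suc l)) (λ l → d (suc l)) i)

jMinus : ∀ {n} → Pair n → ℕ × ℕ → ℕ
jMinus σ (i , j) = maxBelow (λ k → InX σ (i , k)) (λ k → InX? σ (i , k)) j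

left : ∀ {n} → Pair n → ℕ × ℕ → ℕ × ℕ
left σ (i , j) = (i , jMinus σ (i , j))

iMinus : ∀ {n} → Pair n → ℕ × ℕ → ℕ
iMinus σ (i , j) =
  minUpTo (λ l → InX σ (l , jm) × D≡0 (up σ) (i , j) (l , jm))
          (λ l → InX? σ (l , jm) ×-dec D≡0? (up σ) (i , j) (l , jm))
          i
  where jm = jMinus σ (i , j)

upArrow : ∀ {n} → Pair n → ℕ × ℕ → ℕ × ℕ
upArrow σ (i , j) = (iMinus σ (i , j) , j)

UpMaximal : ∀ {n} → Pair n → ℕ × ℕ → Set
UpMaximal σ p = upArrow σ p ≡ p

-- For τ = (w,x) and t = t_{a,b} ∈ R_τ:  τ_t = (w, x t),  (x t, x).

InR : ∀ {n} → Pair n → Fin n → Fin n → Set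
InR τ a b = (toℕ a < toℕ b)
          × (down τ <B (down τ ·t[ a , b ])) × ((down τ ·t[ a , b ]) ≤B up τ)

τ[_] : ∀ {n} (τ : Pair n) {a b : Fin n} → InR τ a b → Pair n
τ[ τ ] {a} {b} r = pair (up τ) (down τ ·t[ a , b ]) (proj₂ (proj₂ r))

lowerPair : ∀ {n} (τ : Pair n) {a b : Fin n} → InR τ a b → Pair n
lowerPair τ {a} {b} r = pair (down τ ·t[ a , b ]) (down τ) (proj₁ (proj₁ (proj₂ r)))

module Submission where

-- Everything rests on rank functions being sums of indicators over Fin n.
-- Since x < xt in Bruhat order, x(i₁) < x(i₂) (a step in the other direction
-- would lose inversions), so rk_{xt} = rk_x − R for the indicator R of the
-- rectangle (i₁ , i₂] × (x(i₁) , x(i₂)]; with rk_w ≤ rk_{xt} (rank functions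
-- are antitone along the Bruhat order) this says X_τ ⊆ X_{τ_t}, the two agree
-- off R, X_τ misses R and X^c_{(xt,x)} = R.  The box identity (inclusion–
-- exclusion for rk) turns D_w = 0 into the emptiness of a rectangle.
--
-- Then q ∈ R, row i lies below R, hence p^←_{τ_t} = p^←_τ = (i , j') and i'
-- is the least row with a candidate in column j'.  A candidate l < i' for
-- q^↑_τ would, by gluing empty rectangles and comparing the box identities
-- of w and x (X-transfer), be an earlier candidate for p^↑_{τ_t}.

open import Defs
open import Data.Empty using (⊥-elim)
open import Data.Fin using (Fin; toℕ; zero; suc)
open import Data.Fin.Properties using (toℕ-injective) renaming (_≟_ to _≟ᶠ_)
open import Data.Fin.Permutation using (_⟨$⟩ʳ_; _⟨$⟩ˡ_)
import Data.Fin.Permutation as Perm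
import Data.Fin.Permutation.Components as PC
open import Data.List using (List; length; filter; tabulate; map; concatMap; _++_)
open import Data.List.Properties using (filter-++; length-++; map-tabulate)
open import Data.Nat using (ℕ; zero; suc; _+_; _*_; _∸_; _≤_; _<_; _<?_; _≟_; z≤n; s≤s; z<s)
open import Data.Nat.Properties
open import Data.Nat.Tactic.RingSolver using (solve-∀)
open import Data.Product using (_×_; _,_; proj₁; proj₂)
open import Data.Sum using (_⊎_; inj₁; inj₂; [_,_]′; map₂)
open import Function using (_∘_)
open import Relation.Binary.Construct.Closure.ReflexiveTransitive using (ε; _◅_)
open import Relation.Binary.Definitions using (tri<; tri≈; tri>)
open import Relation.Binary.PropositionalEquality
  using (_≡_; _≢_; refl; sym; trans; cong; cong₂; subst; subst₂; module ≡-Reasoning)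
open import Relation.Nullary using (Dec; yes; no; ¬_)
open import Relation.Nullary.Decidable using (_×-dec_; dec-true; dec-false)
open import Relation.Unary using (Decidable)
open import Algebra.Properties.CommutativeMonoid.Sum +-0-commutativeMonoid
  using (sum; sum-cong-≗; ∑-distrib-+; ∑-comm; sum-permute; sum-replicate-zero)

𝟙 : ∀ {p} {P : Set p} → Dec P → ℕ
𝟙 (yes _) = 1
𝟙 (no _)  = 0

𝟙-yes : ∀ {p} {P : Set p} (d : Dec P) → P → 𝟙 d ≡ 1
𝟙-yes (yes _) _  = refl
𝟙-yes (no ¬p) p = ⊥-elim (¬p p)

𝟙-no : ∀ {p} {P : Set p} (d : Dec P) → ¬ P → 𝟙 d ≡ 0
𝟙-no (yes p) ¬p = ⊥-elim (¬p p)
𝟙-no (no _)  _  = refl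

𝟙-× : ∀ {p q} {P : Set p} {Q : Set q} (d : Dec P) (e : Dec Q) → 𝟙 (d ×-dec e) ≡ 𝟙 d * 𝟙 e
𝟙-× (yes _) (yes _) = refl
𝟙-× (yes _) (no _)  = refl
𝟙-× (no _)  _       = refl

⟦_<_⟧ : ℕ → ℕ → ℕ
⟦ m < i ⟧ = 𝟙 (m <? i)

⟦<⟧-yes : ∀ {m i} → m < i → ⟦ m < i ⟧ ≡ 1
⟦<⟧-yes {m} {i} = 𝟙-yes (m <? i)

⟦<⟧-no : ∀ {m i} → i ≤ m → ⟦ m < i ⟧ ≡ 0
⟦<⟧-no {m} {i} i≤m = 𝟙-no (m <? i) (≤⇒≯ i≤m)

⟦<⟧-monoʳ : ∀ m {i i'} → i ≤ i' → ⟦ m < i ⟧ ≤ ⟦ m < i' ⟧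
⟦<⟧-monoʳ m {i} i≤i' with m <? i
... | yes m<i = ≤-reflexive (sym (⟦<⟧-yes (<-≤-trans m<i i≤i')))
... | no _    = z≤n

⟦<⟧-monoˡ : ∀ {m m'} i → m ≤ m' → ⟦ m' < i ⟧ ≤ ⟦ m < i ⟧
⟦<⟧-monoˡ {m' = m'} i m≤m' with m' <? i
... | yes m'<i = ≤-reflexive (sym (⟦<⟧-yes (≤-<-trans m≤m' m'<i)))
... | no _     = z≤n

⟪_<_≤_⟫ : ℕ → ℕ → ℕ → ℕ
⟪ α < m ≤ β ⟫ = ⟦ α < m ⟧ ∸ ⟦ β < m ⟧

interval-in : ∀ {α m β} → α < m → m ≤ β → ⟪ α < m ≤ β ⟫ ≡ 1
interval-in α<m m≤β rewrite ⟦<⟧-yes α<m | ⟦<⟧-no m≤β = refl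

interval-pos : ∀ α m β → ⟪ α < m ≤ β ⟫ ≢ 0 → α < m × m ≤ β
interval-pos α m β nz with α <? m | β <? m
... | no _    | yes _   = ⊥-elim (nz refl)
... | no _    | no _    = ⊥-elim (nz refl)
... | yes _   | yes _   = ⊥-elim (nz refl)
... | yes α<m | no β≮m  = α<m , ≮⇒≥ β≮m

-- (A − a)(B − b) = AB + ab − Ab − aB, phrased without negative numbers.
cross-identity : ∀ {a A b B} → a ≤ A → b ≤ B →
  A * B + a * b ≡ A * b + a * B + (A ∸ a) * (B ∸ b)
cross-identity {a} {A} {b} {B} a≤A b≤B = begin
    A * B + a * b
  ≡⟨ cong₂ (λ X Y → X * Y + a * b) (sym eA) (sym eB) ⟩
    (a + A') * (b + B') + a * b
  ≡⟨ expand a A' b B' ⟩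
    (a + A') * b + a * (b + B') + A' * B'
  ≡⟨ cong₂ (λ X Y → X * b + a * Y + A' * B') eA eB ⟩
    A * b + a * B + A' * B' ∎
  where
  open ≡-Reasoning
  A' B' : ℕ
  A' = A ∸ a
  B' = B ∸ b
  eA : a + A' ≡ A
  eA = m+[n∸m]≡n a≤A
  eB : b + B' ≡ B
  eB = m+[n∸m]≡n b≤B
  expand : ∀ a A' b B' → (a + A') * (b + B') + a * b ≡ (a + A') * b + a * (b + B') + A' * B'
  expand = solve-∀

sum-mono : ∀ {n} {f g : Fin n → ℕ} → (∀ u → f u ≤ g u) → sum f ≤ sum g
sum-mono {zero}  f≤g = z≤n
sum-mono {suc n} f≤g = +-mono-≤ (f≤g zero) (sum-mono (f≤g ∘ suc))

sum-mono-strict : ∀ {n} {f g : Fin n → ℕ} → (∀ u → f u ≤ g u) →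
  (c : Fin n) → f c < g c → sum f < sum g
sum-mono-strict f≤g zero    lt = +-mono-<-≤ lt (sum-mono (f≤g ∘ suc))
sum-mono-strict f≤g (suc c) lt = +-mono-≤-< (f≤g zero) (sum-mono-strict (f≤g ∘ suc) c lt)

sum-≥-term : ∀ {n} (f : Fin n → ℕ) (c : Fin n) → f c ≤ sum f
sum-≥-term f zero    = m≤m+n _ _
sum-≥-term f (suc c) = ≤-trans (sum-≥-term (f ∘ suc) c) (m≤n+m _ _)

δ : ∀ {n} → Fin n → ℕ → Fin n → ℕ
δ zero    c zero    = c
δ zero    c (suc _) = 0
δ (suc a) c zero    = 0
δ (suc a) c (suc u) = δ a c u

sum-δ : ∀ {n} (a : Fin n) c → sum (δ a c) ≡ c
sum-δ {suc n} zero    c = trans (cong (c +_) (sum-replicate-zero n)) (+-identityʳ c)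
sum-δ {suc n} (suc a) c = sum-δ a c

δ-at : ∀ {n} (a : Fin n) c → δ a c a ≡ c
δ-at zero    c = refl
δ-at (suc a) c = δ-at a c

δ-off : ∀ {n} (a u : Fin n) c → u ≢ a → δ a c u ≡ 0
δ-off zero    zero    c u≢a = ⊥-elim (u≢a refl)
δ-off zero    (suc u) c u≢a = refl
δ-off (suc a) zero    c u≢a = refl
δ-off (suc a) (suc u) c u≢a = δ-off a u c (u≢a ∘ cong suc)

sum-two-point : ∀ {n} (a b : Fin n) (f g : Fin n → ℕ) (k : ℕ) → a ≢ b →
  (∀ u → u ≢ a → u ≢ b → f u ≡ g u) → f a + f b + k ≡ g a + g b → sum f + k ≡ sum g
sum-two-point {n} a b f g k a≢b agree ends =
  +-cancelʳ-≡ (f a + f b) (sum f + k) (sum g) (begin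
    sum f + k + (f a + f b)   ≡⟨ shuffle (sum f) k (f a + f b) ⟩
    sum f + (f a + f b + k)   ≡⟨ cong (sum f +_) ends ⟩
    sum f + (g a + g b)       ≡⟨ summed ⟩
    sum g + (f a + f b)       ∎)
  where
  open ≡-Reasoning
  shuffle : ∀ x y z → x + y + z ≡ x + (z + y)
  shuffle = solve-∀
  swap-at-a : ∀ x y → x + (y + 0) ≡ y + (x + 0)
  swap-at-a = solve-∀
  swap-at-b : ∀ x y → x + (0 + y) ≡ y + (0 + x)
  swap-at-b = solve-∀
  pointwise : ∀ u → f u + (δ a (g a) u + δ b (g b) u) ≡ g u + (δ a (f a) u + δ b (f b) u)
  pointwise u with u ≟ᶠ a | u ≟ᶠ b
  ... | yes refl | _ rewrite δ-at u (g a) | δ-at u (f a) | δ-off b u (g b) a≢b | δ-off b u (f b) a≢b =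
    swap-at-a (f u) (g u)
  ... | no u≢a | yes refl rewrite δ-at u (g b) | δ-at u (f b) | δ-off a u (g a) u≢a | δ-off a u (f a) u≢a =
    swap-at-b (f u) (g u)
  ... | no u≢a | no u≢b rewrite δ-off a u (g a) u≢a | δ-off a u (f a) u≢a
                              | δ-off b u (g b) u≢b | δ-off b u (f b) u≢b =
    cong (_+ 0) (agree u u≢a u≢b)
  summed : sum f + (g a + g b) ≡ sum g + (f a + f b)
  summed = begin
    sum f + (g a + g b)
      ≡⟨ cong (sum f +_) (sym (cong₂ _+_ (sum-δ a (g a)) (sum-δ b (g b)))) ⟩
    sum f + (sum (δ a (g a)) + sum (δ b (g b)))
      ≡⟨ sym (trans (∑-distrib-+ f _) (cong (sum f +_) (∑-distrib-+ (δ a (g a)) (δ b (g b))))) ⟩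
    sum (λ u → f u + (δ a (g a) u + δ b (g b) u))
      ≡⟨ sum-cong-≗ pointwise ⟩
    sum (λ u → g u + (δ a (f a) u + δ b (f b) u))
      ≡⟨ trans (∑-distrib-+ g _) (cong (sum g +_) (∑-distrib-+ (δ a (f a)) (δ b (f b)))) ⟩
    sum g + (sum (δ a (f a)) + sum (δ b (f b)))
      ≡⟨ cong (sum g +_) (cong₂ _+_ (sum-δ a (f a)) (sum-δ b (f b))) ⟩
    sum g + (f a + f b) ∎

count-tabulate : ∀ {a p} {A : Set a} {P : A → Set p} (P? : Decidable P) {n} (g : Fin n → A) →
  length (filter P? (tabulate g)) ≡ sum (λ u → 𝟙 (P? (g u)))
count-tabulate P? {zero}  g = refl
count-tabulate P? {suc n} g with P? (g zero)
... | yes _ = cong suc (count-tabulate P? (g ∘ suc))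
... | no _  = count-tabulate P? (g ∘ suc)

count-concatMap : ∀ {a b p} {A : Set a} {B : Set b} {P : B → Set p} (P? : Decidable P)
  {n} (g : Fin n → A) (h : A → List B) →
  length (filter P? (concatMap h (tabulate g))) ≡ sum (λ u → length (filter P? (h (g u))))
count-concatMap P? {zero}  g h = refl
count-concatMap P? {suc n} g h = begin
    length (filter P? (h (g zero) ++ concatMap h (tabulate (g ∘ suc))))
  ≡⟨ cong length (filter-++ P? (h (g zero)) _) ⟩
    length (filter P? (h (g zero)) ++ filter P? (concatMap h (tabulate (g ∘ suc))))
  ≡⟨ length-++ (filter P? (h (g zero))) ⟩
    length (filter P? (h (g zero))) + length (filter P? (concatMap h (tabulate (g ∘ suc))))
  ≡⟨ cong (length (filter P? (h (g zero))) +_) (count-concatMap P? (g ∘ suc) h) ⟩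
    sum (λ u → length (filter P? (h (g u)))) ∎
  where open ≡-Reasoning

_$_ : ∀ {n} → Perm n → Fin n → ℕ
w $ u = toℕ (w ⟨$⟩ʳ u)

rk-as-sum : ∀ {n} (w : Perm n) i j → rk w i j ≡ sum (λ u → ⟦ toℕ u < i ⟧ * ⟦ w $ u < j ⟧)
rk-as-sum w i j = trans (count-tabulate (λ u → (toℕ u <? i) ×-dec (w $ u <? j)) (λ u → u))
                        (sum-cong-≗ (λ u → 𝟙-× (toℕ u <? i) (w $ u <? j)))

rk-col-zero : ∀ {n} (w : Perm n) i → rk w i 0 ≡ 0
rk-col-zero {n} w i = begin
    rk w i 0
  ≡⟨ rk-as-sum w i 0 ⟩
    sum (λ u → ⟦ toℕ u < i ⟧ * ⟦ w $ u < 0 ⟧)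
  ≡⟨ sum-cong-≗ (λ u → trans (cong (⟦ toℕ u < i ⟧ *_) (⟦<⟧-no {w $ u} z≤n)) (*-zeroʳ ⟦ toℕ u < i ⟧)) ⟩
    sum {n} (λ _ → 0)
  ≡⟨ sum-replicate-zero n ⟩
    0 ∎
  where open ≡-Reasoning

col-zero-in-X : ∀ {n} (σ : Pair n) i → InX σ (i , 0)
col-zero-in-X σ i = trans (rk-col-zero (down σ) i) (sym (rk-col-zero (up σ) i))

-- boxCount w l i k j counts the u with l ≤ u < i and k ≤ w(u) < j,
-- i.e. the points of w in the rectangle (l , i] × (k , j] of □.
boxTerm : ∀ {n} → Perm n → ℕ → ℕ → ℕ → ℕ → Fin n → ℕ
boxTerm w l i k j u = (⟦ toℕ u < i ⟧ ∸ ⟦ toℕ u < l ⟧) * (⟦ w $ u < j ⟧ ∸ ⟦ w $ u < k ⟧)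

boxCount : ∀ {n} → Perm n → ℕ → ℕ → ℕ → ℕ → ℕ
boxCount w l i k j = sum (boxTerm w l i k j)

-- Inclusion–exclusion: the rank function determines the box counts.
box-identity : ∀ {n} (w : Perm n) {l i k j} → l ≤ i → k ≤ j →
  rk w i j + rk w l k ≡ rk w i k + rk w l j + boxCount w l i k j
box-identity w {l} {i} {k} {j} l≤i k≤j = begin
    rk w i j + rk w l k
  ≡⟨ cong₂ _+_ (rk-as-sum w i j) (rk-as-sum w l k) ⟩
    sum (term i j) + sum (term l k)
  ≡⟨ sym (∑-distrib-+ (term i j) (term l k)) ⟩
    sum (λ u → term i j u + term l k u)
  ≡⟨ sum-cong-≗ (λ u → cross-identity (⟦<⟧-monoʳ (toℕ u) l≤i) (⟦<⟧-monoʳ (w $ u) k≤j)) ⟩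
    sum (λ u → term i k u + term l j u + boxTerm w l i k j u)
  ≡⟨ ∑-distrib-+ (λ u → term i k u + term l j u) (boxTerm w l i k j) ⟩
    sum (λ u → term i k u + term l j u) + boxCount w l i k j
  ≡⟨ cong (_+ boxCount w l i k j) (∑-distrib-+ (term i k) (term l j)) ⟩
    sum (term i k) + sum (term l j) + boxCount w l i k j
  ≡⟨ cong (_+ boxCount w l i k j) (sym (cong₂ _+_ (rk-as-sum w i k) (rk-as-sum w l j))) ⟩
    rk w i k + rk w l j + boxCount w l i k j ∎
  where
  open ≡-Reasoning
  term : ℕ → ℕ → Fin _ → ℕ
  term a b u = ⟦ toℕ u < a ⟧ * ⟦ w $ u < b ⟧

D≡0⇒box-empty : ∀ {n} (w : Perm n) {l i k j} → l ≤ i → k ≤ j →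
  D≡0 w (i , j) (l , k) → boxCount w l i k j ≡ 0
D≡0⇒box-empty w l≤i k≤j D =
  +-cancelˡ-≡ _ _ 0 (trans (trans (sym (box-identity w l≤i k≤j)) D) (sym (+-identityʳ _)))

box-empty⇒D≡0 : ∀ {n} (w : Perm n) {l i k j} → l ≤ i → k ≤ j →
  boxCount w l i k j ≡ 0 → D≡0 w (i , j) (l , k)
box-empty⇒D≡0 w {l} {i} {k} {j} l≤i k≤j empty =
  trans (box-identity w l≤i k≤j) (trans (cong (rk w i k + rk w l j +_) empty) (+-identityʳ _))

box-monoʳ : ∀ {n} (w : Perm n) {l i k j' j} → j' ≤ j → boxCount w l i k j' ≤ boxCount w l i k j
box-monoʳ w {l} {i} {k} j'≤j = sum-mono (λ u →
  *-monoʳ-≤ (⟦ toℕ u < i ⟧ ∸ ⟦ toℕ u < l ⟧) (∸-monoˡ-≤ ⟦ w $ u < k ⟧ (⟦<⟧-monoʳ (w $ u) j'≤j)))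

box-split : ∀ {n} (w : Perm n) {l i' i J j' j} → l ≤ i' → i' ≤ i → J ≤ j' →
  boxCount w l i j' j ≤ boxCount w l i' J j + boxCount w i' i j' j
box-split w {l} {i'} {i} {J} {j'} {j} l≤i' i'≤i J≤j' =
  subst (boxCount w l i j' j ≤_) (∑-distrib-+ (boxTerm w l i' J j) (boxTerm w i' i j' j))
        (sum-mono covered)
  where
  covered : ∀ u → boxTerm w l i j' j u ≤ boxTerm w l i' J j u + boxTerm w i' i j' j u
  covered u = begin
      (⟦ m < i ⟧ ∸ ⟦ m < l ⟧) * cols j'
    ≡⟨ cong (_* cols j') rows ⟩
      ((⟦ m < i' ⟧ ∸ ⟦ m < l ⟧) + (⟦ m < i ⟧ ∸ ⟦ m < i' ⟧)) * cols j'
    ≡⟨ *-distribʳ-+ (cols j') (⟦ m < i' ⟧ ∸ ⟦ m < l ⟧) _ ⟩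
      (⟦ m < i' ⟧ ∸ ⟦ m < l ⟧) * cols j' + (⟦ m < i ⟧ ∸ ⟦ m < i' ⟧) * cols j'
    ≤⟨ +-monoˡ-≤ _ (*-monoʳ-≤ (⟦ m < i' ⟧ ∸ ⟦ m < l ⟧) (∸-monoʳ-≤ ⟦ w $ u < j ⟧ (⟦<⟧-monoʳ (w $ u) J≤j'))) ⟩
      (⟦ m < i' ⟧ ∸ ⟦ m < l ⟧) * cols J + (⟦ m < i ⟧ ∸ ⟦ m < i' ⟧) * cols j' ∎
    where
    open ≤-Reasoning
    m : ℕ
    m = toℕ u
    cols : ℕ → ℕ
    cols k = ⟦ w $ u < j ⟧ ∸ ⟦ w $ u < k ⟧
    rows : ⟦ m < i ⟧ ∸ ⟦ m < l ⟧ ≡ (⟦ m < i' ⟧ ∸ ⟦ m < l ⟧) + (⟦ m < i ⟧ ∸ ⟦ m < i' ⟧)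
    rows = trans (cong (_∸ ⟦ m < l ⟧) (sym (m+[n∸m]≡n (⟦<⟧-monoʳ m i'≤i))))
                 (+-∸-comm _ (⟦<⟧-monoʳ m l≤i'))

box-point : ∀ {n} (w : Perm n) {l i k j} (u : Fin n) →
  l ≤ toℕ u → toℕ u < i → k ≤ w $ u → w $ u < j → 1 ≤ boxCount w l i k j
box-point w {l} {i} {k} {j} u l≤u u<i k≤wu wu<j =
  ≤-trans (≤-reflexive (sym at-u)) (sum-≥-term (boxTerm w l i k j) u)
  where
  at-u : boxTerm w l i k j u ≡ 1
  at-u rewrite ⟦<⟧-yes u<i | ⟦<⟧-no l≤u | ⟦<⟧-yes wu<j | ⟦<⟧-no k≤wu = refl

D≡0-shrink : ∀ {n} (w : Perm n) {l i' J j' j} → l ≤ i' → J ≤ j' → j' ≤ j →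
  D≡0 w (i' , j) (l , J) → boxCount w l i' J j' ≡ 0
D≡0-shrink w {l} {i'} {J} {j'} {j} l≤i' J≤j' j'≤j D =
  n≤0⇒n≡0 (≤-trans (box-monoʳ w {l} {i'} {J} j'≤j) (≤-reflexive (D≡0⇒box-empty w l≤i' (≤-trans J≤j' j'≤j) D)))

D≡0-compose : ∀ {n} (w : Perm n) {l i' i J j' j} → l ≤ i' → i' ≤ i → J ≤ j' → j' ≤ j →
  D≡0 w (i' , j) (l , J) → D≡0 w (i , j) (i' , j') → D≡0 w (i , j) (l , j')
D≡0-compose w {l} {i'} {i} {J} {j'} {j} l≤i' i'≤i J≤j' j'≤j upper lower =
  box-empty⇒D≡0 w (≤-trans l≤i' i'≤i) j'≤j (n≤0⇒n≡0 (begin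
    boxCount w l i j' j
  ≤⟨ box-split w l≤i' i'≤i J≤j' ⟩
    boxCount w l i' J j + boxCount w i' i j' j
  ≡⟨ cong₂ _+_ (D≡0⇒box-empty w l≤i' (≤-trans J≤j' j'≤j) upper) (D≡0⇒box-empty w i'≤i j'≤j lower) ⟩
    0 ∎))
  where open ≤-Reasoning

t : ∀ {n} → Fin n → Fin n → Fin n → Fin n
t = PC.transpose

t-at-a : ∀ {n} (a b : Fin n) → t a b a ≡ b
t-at-a a b rewrite dec-true (a ≟ᶠ a) refl = refl

t-at-b : ∀ {n} (a b : Fin n) → t a b b ≡ a
t-at-b a b with b ≟ᶠ a
... | yes b≡a = b≡a
... | no _ rewrite dec-true (b ≟ᶠ b) refl = refl

t-off : ∀ {n} (a b k : Fin n) → k ≢ a → k ≢ b → t a b k ≡ k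
t-off a b k k≢a k≢b rewrite dec-false (k ≟ᶠ a) k≢a | dec-false (k ≟ᶠ b) k≢b = refl

Swapped : ∀ {n} → Perm n → Fin n → Fin n → Perm n → Set
Swapped x a b y = ∀ k → y ⟨$⟩ʳ k ≡ x ⟨$⟩ʳ t a b k

rect : ℕ → ℕ → ℕ → ℕ → ℕ → ℕ → ℕ
rect α β μ ν i j = ⟪ α < i ≤ β ⟫ * ⟪ μ < j ≤ ν ⟫

rect-in : ∀ {α β μ ν i j} → α < i → i ≤ β → μ < j → j ≤ ν → rect α β μ ν i j ≡ 1
rect-in α<i i≤β μ<j j≤ν rewrite interval-in α<i i≤β | interval-in μ<j j≤ν = refl

rect-pos : ∀ α β μ ν i j → rect α β μ ν i j ≢ 0 → (α < i × i ≤ β) × (μ < j × j ≤ ν)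
rect-pos α β μ ν i j nz =
  interval-pos α i β (λ e → nz (cong (_* ⟪ μ < j ≤ ν ⟫) e)) ,
  interval-pos μ j ν (λ e → nz (trans (cong (⟪ α < i ≤ β ⟫ *_) e) (*-zeroʳ ⟪ α < i ≤ β ⟫)))

rk-swap : ∀ {n} (x y : Perm n) (a b : Fin n) → toℕ a < toℕ b → x $ a < x $ b → Swapped x a b y →
  ∀ i j → rk y i j + rect (toℕ a) (toℕ b) (x $ a) (x $ b) i j ≡ rk x i j
rk-swap x y a b a<b xa<xb y≡xt i j = begin
    rk y i j + R
  ≡⟨ cong (_+ R) (rk-as-sum y i j) ⟩
    sum (term y) + R
  ≡⟨ sum-two-point a b (term y) (term x) R a≢b off ends ⟩
    sum (term x)
  ≡⟨ sym (rk-as-sum x i j) ⟩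
    rk x i j ∎
  where
  open ≡-Reasoning
  R : ℕ
  R = rect (toℕ a) (toℕ b) (x $ a) (x $ b) i j
  term : Perm _ → Fin _ → ℕ
  term z u = ⟦ toℕ u < i ⟧ * ⟦ z $ u < j ⟧
  a≢b : a ≢ b
  a≢b a≡b = <-irrefl (cong toℕ a≡b) a<b
  off : ∀ u → u ≢ a → u ≢ b → term y u ≡ term x u
  off u u≢a u≢b = cong (λ v → ⟦ toℕ u < i ⟧ * ⟦ toℕ v < j ⟧)
                       (trans (y≡xt u) (cong (x ⟨$⟩ʳ_) (t-off a b u u≢a u≢b)))
  ya : y $ a ≡ x $ b
  ya = cong toℕ (trans (y≡xt a) (cong (x ⟨$⟩ʳ_) (t-at-a a b)))
  yb : y $ b ≡ x $ a
  yb = cong toℕ (trans (y≡xt b) (cong (x ⟨$⟩ʳ_) (t-at-b a b)))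
  ends : term y a + term y b + R ≡ term x a + term x b
  ends rewrite ya | yb = sym (cross-identity (⟦<⟧-monoˡ i (<⇒≤ a<b)) (⟦<⟧-monoˡ j (<⇒≤ xa<xb)))

invTerm : ∀ {n} → Perm n → Fin n → Fin n → ℕ
invTerm w c d = ⟦ toℕ c < toℕ d ⟧ * ⟦ w $ d < w $ c ⟧

inversions-as-sum : ∀ {n} (w : Perm n) → inversions w ≡ sum (λ c → sum (invTerm w c))
inversions-as-sum {n} w =
  trans (count-concatMap isInv (λ u → u) row)
        (sum-cong-≗ λ c → trans (cong (length ∘ filter isInv) (map-tabulate (λ u → u) (c ,_)))
                         (trans (count-tabulate isInv (c ,_))
                                (sum-cong-≗ λ d → 𝟙-× (toℕ c <? toℕ d) (w $ d <? w $ c))))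
  where
  isInv : (cd : Fin n × Fin n) → Dec (toℕ (proj₁ cd) < toℕ (proj₂ cd) × w $ proj₂ cd < w $ proj₁ cd)
  isInv cd = (toℕ (proj₁ cd) <? toℕ (proj₂ cd)) ×-dec (w $ proj₂ cd <? w $ proj₁ cd)
  row : Fin n → List (Fin n × Fin n)
  row c = map (c ,_) (tabulate (λ u → u))

choose : ∀ {p} {P : Set p} → Dec P → ℕ → ℕ → ℕ
choose (yes _) m k = m
choose (no _)  m k = k

choose-no : ∀ {p} {P : Set p} (d : Dec P) → ¬ P → ∀ m k → choose d m k ≡ k
choose-no (yes p) ¬p m k = ⊥-elim (¬p p)
choose-no (no _)  _  m k = refl

data Where {n} (a b : Fin n) : Fin n → Set where
  at-a      : Where a b a
  at-b      : Where a b b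
  elsewhere : ∀ {k} → k ≢ a → k ≢ b → Where a b k

where? : ∀ {n} (a b k : Fin n) → Where a b k
where? a b k with k ≟ᶠ a | k ≟ᶠ b
... | yes refl | _        = at-a
... | no _     | yes refl = at-b
... | no k≢a   | no k≢b   = elsewhere k≢a k≢b

-- After relabelling positions by t_{a,b}, the inversion table A of x t_{a,b}
-- is dominated entrywise by a rearrangement B₂ of the inversion table B of
-- x (rows, resp. columns, strictly between a and b are relabelled), and
-- strictly so at (a , b).
module InversionDrop {n} (x : Perm n) (a b : Fin n) (a<b : toℕ a < toℕ b) (xb<xa : x $ b < x $ a) where

  -- s = t_{a,b} (written t b a so that y ∘ s = x for y = x t_{a,b}).
  s : Fin n → Fin n
  s = t b a

  s-a : s a ≡ b
  s-a = t-at-b b a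

  s-b : s b ≡ a
  s-b = t-at-a b a

  s-off : ∀ {k} → k ≢ a → k ≢ b → s k ≡ k
  s-off {k} k≢a k≢b = t-off b a k k≢b k≢a

  reindex : (f : Fin n → ℕ) → sum f ≡ sum (f ∘ s)
  reindex f = sum-permute f (Perm.transpose b a)

  Inside : Fin n → Set
  Inside k = toℕ a < toℕ k × toℕ k < toℕ b

  inside? : ∀ k → Dec (Inside k)
  inside? k = (toℕ a <? toℕ k) ×-dec (toℕ k <? toℕ b)

  s-inside : ∀ {k} → Inside k → s k ≡ k
  s-inside (a<k , k<b) = s-off (λ k≡a → <-irrefl (sym (cong toℕ k≡a)) a<k) (λ k≡b → <-irrefl (cong toℕ k≡b) k<b)

  B A B₁ B₂ : Fin n → Fin n → ℕ
  B = invTerm x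
  A c d = ⟦ toℕ (s c) < toℕ (s d) ⟧ * ⟦ x $ d < x $ c ⟧
  B₁ c d = choose (inside? d) (B (s c) d) (B c d)
  B₂ c d = choose (inside? c) (B₁ c (s d)) (B₁ c d)

  -- Each relabelling permutes a single row or column, so B₂ has the total of B.
  total-B₂ : sum (λ c → sum (B₂ c)) ≡ sum (λ c → sum (B c))
  total-B₂ = begin
      sum (λ c → sum (B₂ c))
    ≡⟨ sum-cong-≗ rows ⟩
      sum (λ c → sum (B₁ c))
    ≡⟨ ∑-comm B₁ ⟩
      sum (λ d → sum (λ c → B₁ c d))
    ≡⟨ sum-cong-≗ columns ⟩
      sum (λ d → sum (λ c → B c d))
    ≡⟨ ∑-comm B ⟨
      sum (λ c → sum (B c)) ∎
    where
    open ≡-Reasoning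
    rows : ∀ c → sum (B₂ c) ≡ sum (B₁ c)
    rows c with inside? c
    ... | yes _ = sym (reindex (B₁ c))
    ... | no _  = refl
    columns : ∀ d → sum (λ c → B₁ c d) ≡ sum (λ c → B c d)
    columns d with inside? d
    ... | yes _ = sym (reindex (λ c → B c d))
    ... | no _  = refl

  inv : ∀ {c d} → toℕ c < toℕ d → x $ d < x $ c → B c d ≡ 1
  inv c<d xd<xc rewrite ⟦<⟧-yes c<d | ⟦<⟧-yes xd<xc = refl

  lower-s : ∀ {c d} → d ≢ b → x $ d < x $ c → x $ s d < x $ c
  lower-s {c} {d} d≢b xd<xc with where? a b d
  ... | at-a = subst (λ k → x $ k < x $ c) (sym s-a) (<-trans xb<xa xd<xc)
  ... | at-b = ⊥-elim (d≢b refl)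
  ... | elsewhere d≢a _ = subst (λ k → x $ k < x $ c) (sym (s-off d≢a d≢b)) xd<xc

  upper-s : ∀ {c d} → c ≢ a → x $ d < x $ c → x $ d < x $ s c
  upper-s {c} {d} c≢a xd<xc with where? a b c
  ... | at-a = ⊥-elim (c≢a refl)
  ... | at-b = subst (λ k → x $ d < x $ k) (sym s-b) (<-trans xd<xc xb<xa)
  ... | elsewhere _ c≢b = subst (λ k → x $ d < x $ k) (sym (s-off c≢a c≢b)) xd<xc

  order-outside : ∀ c d → ¬ Inside c → ¬ Inside d → x $ d < x $ c →
    toℕ (s c) < toℕ (s d) → toℕ c < toℕ d
  order-outside c d c-out d-out xd<xc sc<sd with where? a b c | where? a b d
  ... | at-a | at-a = ⊥-elim (<-irrefl refl sc<sd)
  ... | at-a | at-b = ⊥-elim (<-asym a<b (subst₂ (λ k l → toℕ k < toℕ l) s-a s-b sc<sd))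
  ... | at-a | elsewhere d≢a d≢b =
    <-trans a<b (subst₂ (λ k l → toℕ k < toℕ l) s-a (s-off d≢a d≢b) sc<sd)
  ... | at-b | at-a = ⊥-elim (<-asym xb<xa xd<xc)
  ... | at-b | at-b = ⊥-elim (<-irrefl refl sc<sd)
  ... | at-b | elsewhere d≢a d≢b =
    ≤∧≢⇒< (≮⇒≥ (λ d<b → d-out (a<d , d<b))) (λ b≡d → d≢b (toℕ-injective (sym b≡d)))
    where
    a<d : toℕ a < toℕ d
    a<d = subst₂ (λ k l → toℕ k < toℕ l) s-b (s-off d≢a d≢b) sc<sd
  ... | elsewhere c≢a c≢b | at-a =
    ≤∧≢⇒< (≮⇒≥ (λ a<c → c-out (a<c , c<b))) (λ c≡a → c≢a (toℕ-injective c≡a))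
    where
    c<b : toℕ c < toℕ b
    c<b = subst₂ (λ k l → toℕ k < toℕ l) (s-off c≢a c≢b) s-a sc<sd
  ... | elsewhere c≢a c≢b | at-b =
    <-trans (subst₂ (λ k l → toℕ k < toℕ l) (s-off c≢a c≢b) s-b sc<sd) a<b
  ... | elsewhere c≢a c≢b | elsewhere d≢a d≢b =
    subst₂ (λ k l → toℕ k < toℕ l) (s-off c≢a c≢b) (s-off d≢a d≢b) sc<sd

  A⇒B₂ : ∀ c d → toℕ (s c) < toℕ (s d) → x $ d < x $ c → B₂ c d ≡ 1
  A⇒B₂ c d sc<sd xd<xc with inside? c
  ... | yes c-in = row (inside? (s d))
    where
    sc≡c : s c ≡ c
    sc≡c = s-inside c-in
    c<sd : toℕ c < toℕ (s d)
    c<sd = subst (λ k → toℕ k < toℕ (s d)) sc≡c sc<sd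
    d≢b : d ≢ b
    d≢b refl = <-asym (proj₁ c-in) (subst (λ k → toℕ c < toℕ k) s-b c<sd)
    row : (i? : Dec (Inside (s d))) → choose i? (B (s c) (s d)) (B c (s d)) ≡ 1
    row (yes _) = subst (λ k → B k (s d) ≡ 1) (sym sc≡c) (inv c<sd (lower-s d≢b xd<xc))
    row (no _)  = inv c<sd (lower-s d≢b xd<xc)
  ... | no c-out with inside? d
  ...   | yes d-in = inv sc<d (upper-s c≢a xd<xc)
    where
    sc<d : toℕ (s c) < toℕ d
    sc<d = subst (λ k → toℕ (s c) < toℕ k) (s-inside d-in) sc<sd
    c≢a : c ≢ a
    c≢a refl = <-asym (proj₂ d-in) (subst (λ k → toℕ k < toℕ d) s-a sc<d)
  ...   | no d-out = inv (order-outside c d c-out d-out xd<xc sc<sd) xd<xc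

  A≤B₂ : ∀ c d → A c d ≤ B₂ c d
  A≤B₂ c d = bound (toℕ (s c) <? toℕ (s d)) (x $ d <? x $ c)
    where
    bound : ∀ (p : Dec (toℕ (s c) < toℕ (s d))) (q : Dec (x $ d < x $ c)) → 𝟙 p * 𝟙 q ≤ B₂ c d
    bound (yes sc<sd) (yes xd<xc) = ≤-reflexive (sym (A⇒B₂ c d sc<sd xd<xc))
    bound (yes _)     (no _)      = z≤n
    bound (no _)      _           = z≤n

  A-ab : A a b ≡ 0
  A-ab rewrite s-a | s-b = cong (_* ⟦ x $ b < x $ a ⟧) (⟦<⟧-no (<⇒≤ a<b))

  B₂-ab : B₂ a b ≡ 1
  B₂-ab = trans (choose-no (inside? a) (λ (a<a , _) → <-irrefl refl a<a) _ _)
         (trans (choose-no (inside? b) (λ (_ , b<b) → <-irrefl refl b<b) _ _) (inv a<b xb<xa))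

  inversions-drop : (y : Perm n) → Swapped x a b y → inversions y < inversions x
  inversions-drop y y≡xt = begin-strict
      inversions y
    ≡⟨ inversions-as-sum y ⟩
      sum (λ c → sum (invTerm y c))
    ≡⟨ trans (reindex _) (sum-cong-≗ λ c → trans (reindex _) (sum-cong-≗ λ d → relabel c d)) ⟩
      sum (λ c → sum (A c))
    <⟨ sum-mono-strict (λ c → sum-mono (A≤B₂ c)) a
         (sum-mono-strict (A≤B₂ a) b (subst₂ _<_ (sym A-ab) (sym B₂-ab) z<s)) ⟩
      sum (λ c → sum (B₂ c))
    ≡⟨ total-B₂ ⟩
      sum (λ c → sum (B c))
    ≡⟨ inversions-as-sum x ⟨
      inversions x ∎
    where
    open ≤-Reasoning
    y∘s : ∀ k → y $ s k ≡ x $ k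
    y∘s k = cong toℕ (trans (y≡xt (s k)) (cong (x ⟨$⟩ʳ_) (PC.transpose-inverse a b)))
    relabel : ∀ c d → invTerm y (s c) (s d) ≡ A c d
    relabel c d = cong₂ (λ u v → ⟦ toℕ (s c) < toℕ (s d) ⟧ * ⟦ u < v ⟧) (y∘s d) (y∘s c)

step-direction : ∀ {n} (x y : Perm n) (a b : Fin n) → toℕ a < toℕ b →
  inversions x < inversions y → Swapped x a b y → x $ a < x $ b
step-direction x y a b a<b up y≡xt with <-cmp (x $ a) (x $ b)
... | tri< xa<xb _ _ = xa<xb
... | tri≈ _ xa≡xb _ = ⊥-elim (<-irrefl (cong toℕ a≡b) a<b)
  where
  a≡b : a ≡ b
  a≡b = trans (sym (Perm.inverseˡ x)) (trans (cong (x ⟨$⟩ˡ_) (toℕ-injective xa≡xb)) (Perm.inverseˡ x))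
... | tri> _ _ xb<xa = ⊥-elim (<-asym up (InversionDrop.inversions-drop x a b a<b xb<xa y y≡xt))

rk-antitone : ∀ {n} {x y : Perm n} → x ≤B y → ∀ i j → rk y i j ≤ rk x i j
rk-antitone ε i j = ≤-refl
rk-antitone {x = x} (_◅_ {j = z} (a , b , a<b , z≡xt , up) z≤y) i j =
  ≤-trans (rk-antitone z≤y i j)
          (subst (rk z i j ≤_) (rk-swap x z a b a<b (step-direction x z a b a<b up z≡xt) z≡xt i j)
                 (m≤m+n _ _))

inversions-mono : ∀ {n} {x y : Perm n} → x ≤B y → inversions x ≤ inversions y
inversions-mono ε = ≤-refl
inversions-mono (_◅_ (_ , _ , _ , _ , up) z≤y) = ≤-trans (<⇒≤ up) (inversions-mono z≤y)

inversions-strict : ∀ {n} {x y : Perm n} → x <B y → inversions x < inversions y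
inversions-strict (ε , x≢x) = ⊥-elim (x≢x (λ _ → refl))
inversions-strict ((_ , _ , _ , _ , up) ◅ z≤y , _) = <-≤-trans up (inversions-mono z≤y)

maxBelow-spec : (P : ℕ → Set) (P? : ∀ k → Dec (P k)) (j : ℕ) →
  let m = maxBelow P P? j in
  (m < j × P m × (∀ k → m < k → k < j → ¬ P k)) ⊎ (m ≡ 0 × (∀ k → k < j → ¬ P k))
maxBelow-spec P P? zero = inj₂ (refl , λ _ ())
maxBelow-spec P P? (suc j) with P? j
... | yes Pj = inj₁ (≤-refl , Pj , λ k j<k k<1+j _ → <-irrefl refl (<-≤-trans j<k (≤-pred k<1+j)))
... | no ¬Pj with maxBelow-spec P P? j
...   | inj₁ (m<j , Pm , gap) = inj₁ (m<n⇒m<1+n m<j , Pm , gap′)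
  where
  gap′ : ∀ k → maxBelow P P? j < k → k < suc j → ¬ P k
  gap′ k m<k k<1+j with m≤n⇒m<n∨m≡n (≤-pred k<1+j)
  ... | inj₁ k<j  = gap k m<k k<j
  ... | inj₂ refl = ¬Pj
...   | inj₂ (m≡0 , none) = inj₂ (m≡0 , none′)
  where
  none′ : ∀ k → k < suc j → ¬ P k
  none′ k k<1+j with m≤n⇒m<n∨m≡n (≤-pred k<1+j)
  ... | inj₁ k<j  = none k k<j
  ... | inj₂ refl = ¬Pj

maxBelow-cong : (P Q : ℕ → Set) (P? : ∀ k → Dec (P k)) (Q? : ∀ k → Dec (Q k)) →
  (∀ k → P k → Q k) → (∀ k → Q k → P k) → ∀ j → maxBelow P P? j ≡ maxBelow Q Q? j
maxBelow-cong P Q P? Q? P⇒Q Q⇒P zero = refl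
maxBelow-cong P Q P? Q? P⇒Q Q⇒P (suc j) with P? j | Q? j
... | yes _  | yes _  = refl
... | no _   | no _   = maxBelow-cong P Q P? Q? P⇒Q Q⇒P j
... | yes Pj | no ¬Qj = ⊥-elim (¬Qj (P⇒Q j Pj))
... | no ¬Pj | yes Qj = ⊥-elim (¬Pj (Q⇒P j Qj))

minUpTo-spec : (P : ℕ → Set) (P? : ∀ k → Dec (P k)) (i : ℕ) →
  let m = minUpTo P P? i in
  m ≤ i × (∀ l → l < m → ¬ P l) × (P m ⊎ m ≡ i)
minUpTo-spec P P? zero = z≤n , (λ _ ()) , inj₂ refl
minUpTo-spec P P? (suc i) with P? 0
... | yes P0 = z≤n , (λ _ ()) , inj₁ P0
... | no ¬P0 with minUpTo-spec (P ∘ suc) (P? ∘ suc) i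
...   | m≤i , below , found = s≤s m≤i , below′ , map₂ (cong suc) found
  where
  below′ : ∀ l → l < suc (minUpTo (P ∘ suc) (P? ∘ suc) i) → ¬ P l
  below′ zero    _   = ¬P0
  below′ (suc l) l<m = below l (≤-pred l<m)

left-in-X : ∀ {n} (σ : Pair n) i j → InX σ (i , jMinus σ (i , j))
left-in-X σ i j =
  [ (λ found → proj₁ (proj₂ found))
  , (λ none → subst (λ k → InX σ (i , k)) (sym (proj₁ none)) (col-zero-in-X σ i)) ]′
  (maxBelow-spec (λ k → InX σ (i , k)) (λ k → InX? σ (i , k)) j)

left-nearest : ∀ {n} (σ : Pair n) i j → 0 < jMinus σ (i , j) →
  jMinus σ (i , j) < j × (∀ k → jMinus σ (i , j) < k → k < j → ¬ InX σ (i , k))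
left-nearest σ i j pos =
  [ (λ found → proj₁ found , proj₂ (proj₂ found))
  , (λ none → ⊥-elim (<-irrefl (sym (proj₁ none)) pos)) ]′
  (maxBelow-spec (λ k → InX σ (i , k)) (λ k → InX? σ (i , k)) j)

UpCandidate : ∀ {n} → Pair n → ℕ × ℕ → ℕ → Set
UpCandidate σ (i , j) l = InX σ (l , jMinus σ (i , j)) × D≡0 (up σ) (i , j) (l , jMinus σ (i , j))

up-spec : ∀ {n} (σ : Pair n) i j →
  let m = iMinus σ (i , j) in
  m ≤ i × (∀ l → l < m → ¬ UpCandidate σ (i , j) l) × (UpCandidate σ (i , j) m ⊎ m ≡ i)
up-spec σ i j = minUpTo-spec (UpCandidate σ (i , j))
  (λ l → InX? σ (l , jMinus σ (i , j)) ×-dec D≡0? (up σ) (i , j) (l , jMinus σ (i , j))) i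

up-≤ : ∀ {n} (σ : Pair n) {i j i'} → upArrow σ (i , j) ≡ (i' , j) → i' ≤ i
up-≤ σ {i} {j} ↑p≡ = subst (_≤ i) (cong proj₁ ↑p≡) (proj₁ (up-spec σ i j))


up-least : ∀ {n} (σ : Pair n) {i j i' k} → upArrow σ (i , j) ≡ (i' , j) → jMinus σ (i , j) ≡ k → i' < i →
  (InX σ (i' , k) × D≡0 (up σ) (i , j) (i' , k)) ×
  (∀ l → l < i' → ¬ (InX σ (l , k) × D≡0 (up σ) (i , j) (l , k)))
up-least σ {i} {j} {i'} {k} ↑p≡ ←p≡ i'<i =
  [ at-k , (λ m≡i → ⊥-elim (<-irrefl (trans (sym m≡i') m≡i) i'<i)) ]′ (proj₂ (proj₂ spec)) ,
  λ l l<i' → proj₁ (proj₂ spec) l (subst (l <_) (sym m≡i') l<i') ∘ from-k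
  where
  spec : iMinus σ (i , j) ≤ i × (∀ l → l < iMinus σ (i , j) → ¬ UpCandidate σ (i , j) l) ×
         (UpCandidate σ (i , j) (iMinus σ (i , j)) ⊎ iMinus σ (i , j) ≡ i)
  spec = up-spec σ i j
  m≡i' : iMinus σ (i , j) ≡ i'
  m≡i' = cong proj₁ ↑p≡
  Cand : ℕ → ℕ → Set
  Cand c l = InX σ (l , c) × D≡0 (up σ) (i , j) (l , c)
  at-k : UpCandidate σ (i , j) (iMinus σ (i , j)) → Cand k i'
  at-k = subst₂ Cand ←p≡ m≡i'
  from-k : ∀ {l} → Cand k l → UpCandidate σ (i , j) l
  from-k = subst (λ c → Cand c _) (sym ←p≡)

up-maximal : ∀ {n} (σ : Pair n) i j → (∀ l → l < i → ¬ UpCandidate σ (i , j) l) → UpMaximal σ (i , j)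
up-maximal σ i j none = cong (_, j) (settle {iMinus σ (i , j)} (proj₁ spec) (proj₂ (proj₂ spec)))
  where
  spec : iMinus σ (i , j) ≤ i × (∀ l → l < iMinus σ (i , j) → ¬ UpCandidate σ (i , j) l) ×
         (UpCandidate σ (i , j) (iMinus σ (i , j)) ⊎ iMinus σ (i , j) ≡ i)
  spec = up-spec σ i j
  settle : ∀ {m} → m ≤ i → UpCandidate σ (i , j) m ⊎ m ≡ i → m ≡ i
  settle m≤i (inj₂ m≡i) = m≡i
  settle m≤i (inj₁ cand) = [ (λ m<i → ⊥-elim (none _ m<i cand)) , (λ m≡i → m≡i) ]′ (m≤n⇒m<n∨m≡n m≤i)

module Transposed {n} (τ : Pair n) {i₁ i₂ : Fin n} (r : InR τ i₁ i₂) where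

  w x y : Perm n
  w = up τ
  x = down τ
  y = x ·t[ i₁ , i₂ ]

  α β x₁ x₂ : ℕ
  α  = toℕ i₁
  β  = toℕ i₂
  x₁ = x $ i₁
  x₂ = x $ i₂

  -- R is the rectangle (α , β] × (x₁ , x₂] on which rk_{xt} = rk_x − 1.
  R : ℕ → ℕ → ℕ
  R = rect α β x₁ x₂

  -- x < xt in Bruhat order, so the transposition increases x: x(i₁) < x(i₂).
  x₁<x₂ : x₁ < x₂
  x₁<x₂ = step-direction x y i₁ i₂ (proj₁ r) (inversions-strict (proj₁ (proj₂ r))) (λ _ → refl)

  rk-y+R : ∀ i j → rk y i j + R i j ≡ rk x i j
  rk-y+R = rk-swap x y i₁ i₂ (proj₁ r) x₁<x₂ (λ _ → refl)

  w≤y : ∀ i j → rk w i j ≤ rk y i j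
  w≤y = rk-antitone (proj₂ (proj₂ r))

  y≤x : ∀ i j → rk y i j ≤ rk x i j
  y≤x i j = subst (rk y i j ≤_) (rk-y+R i j) (m≤m+n _ _)

  Xt-if-≤ : ∀ {i j} → rk y i j ≤ rk w i j → InX (τ[ τ ] r) (i , j)
  Xt-if-≤ {i} {j} y≤w = ≤-antisym y≤w (w≤y i j)

  X⊆Xt : ∀ {i j} → InX τ (i , j) → InX (τ[ τ ] r) (i , j)
  X⊆Xt {i} {j} X = Xt-if-≤ (≤-trans (y≤x i j) (≤-reflexive X))

  Xt⊆X-off-R : ∀ {i j} → R i j ≡ 0 → InX (τ[ τ ] r) (i , j) → InX τ (i , j)
  Xt⊆X-off-R {i} {j} R≡0 Xt = begin
      rk x i j       ≡⟨ rk-y+R i j ⟨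
      rk y i j + R i j ≡⟨ cong (rk y i j +_) R≡0 ⟩
      rk y i j + 0   ≡⟨ +-identityʳ _ ⟩
      rk y i j       ≡⟨ Xt ⟩
      rk w i j       ∎
    where open ≡-Reasoning

  R-avoids-X : ∀ {i j} → R i j ≡ 1 → ¬ InX τ (i , j)
  R-avoids-X {i} {j} R≡1 X = <-irrefl refl (begin-strict
      rk y i j       <⟨ n<1+n _ ⟩
      suc (rk y i j) ≡⟨ trans (+-comm 1 _) (trans (cong (rk y i j +_) (sym R≡1)) (rk-y+R i j)) ⟩
      rk x i j       ≡⟨ X ⟩
      rk w i j       ≤⟨ w≤y i j ⟩
      rk y i j       ∎)
    where open ≤-Reasoning

  Xc-lower⇒in-R : ∀ {i j} → InXc (lowerPair τ r) (i , j) → (α < i × i ≤ β) × (x₁ < j × j ≤ x₂)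
  Xc-lower⇒in-R {i} {j} Xc = rect-pos α β x₁ x₂ i j λ R≡0 →
    Xc (trans (sym (rk-y+R i j)) (trans (cong (rk y i j +_) R≡0) (+-identityʳ _)))

  left-below-R : ∀ {i} j → β < i → jMinus (τ[ τ ] r) (i , j) ≡ jMinus τ (i , j)
  left-below-R {i} j β<i =
    maxBelow-cong (λ k → InX (τ[ τ ] r) (i , k)) (λ k → InX τ (i , k)) (λ k → InX? (τ[ τ ] r) (i , k)) (λ k → InX? τ (i , k))
                  (λ k → Xt⊆X-off-R (off-R k)) (λ k → X⊆Xt) j
    where
    off-R : ∀ k → R i k ≡ 0
    off-R k with R i k ≟ 0
    ... | yes R≡0 = R≡0
    ... | no R≢0  = ⊥-elim (≤⇒≯ (proj₂ (proj₁ (rect-pos α β x₁ x₂ i k R≢0))) β<i)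

  left-left-of-R : ∀ {i j} → α < i → i ≤ β → j ≤ x₂ → jMinus τ (i , j) ≤ x₁
  left-left-of-R {i} {j} α<i i≤β j≤x₂ = ≮⇒≥ λ x₁<m →
    R-avoids-X (rect-in α<i i≤β x₁<m (≤-trans (<⇒≤ (m<j x₁<m)) j≤x₂)) (left-in-X τ i j)
    where
    m<j : x₁ < jMinus τ (i , j) → jMinus τ (i , j) < j
    m<j x₁<m = proj₁ (left-nearest τ i j (≤-<-trans z≤n x₁<m))

  -- Let (i' , j') ∈ X_{τ_t} lie in R, let (i' , J), (l , J) ∈ X_τ with J ≤ j'
  -- and let w have no point in (l , i'] × (J , j'].  Comparing the box
  -- identities of w and x, the corner (i' , j') ∈ R contributes an extra 1:
  corner-defect : ∀ {l i' J j'} → l ≤ i' → J ≤ j' → R i' j' ≡ 1 →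
    InX (τ[ τ ] r) (i' , j') → InX τ (i' , J) → InX τ (l , J) → boxCount w l i' J j' ≡ 0 →
    rk w l j' + 1 ≡ rk x l j' + boxCount x l i' J j'
  corner-defect {l} {i'} {J} {j'} l≤i' J≤j' R≡1 Xt-i'j' X-i'J X-lJ empty =
    +-cancelˡ-≡ (rk w i' J) _ _ (begin
      rk w i' J + (rk w l j' + 1)       ≡⟨ solve (rk w i' J) (rk w l j') ⟩
      rk w i' J + rk w l j' + 0 + 1     ≡⟨ cong (λ e → rk w i' J + rk w l j' + e + 1) empty ⟨
      rk w i' J + rk w l j' + boxCount w l i' J j' + 1
                                        ≡⟨ cong (_+ 1) (box-identity w l≤i' J≤j') ⟨
      rk w i' j' + rk w l J + 1         ≡⟨ reorder (rk w i' j') (rk w l J) ⟩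
      (rk w i' j' + 1) + rk w l J       ≡⟨ cong₂ (λ u v → u + 1 + v) Xt-i'j' X-lJ ⟨
      (rk y i' j' + 1) + rk x l J       ≡⟨ cong (λ e → rk y i' j' + e + rk x l J) R≡1 ⟨
      (rk y i' j' + R i' j') + rk x l J ≡⟨ cong (_+ rk x l J) (rk-y+R i' j') ⟩
      rk x i' j' + rk x l J             ≡⟨ box-identity x l≤i' J≤j' ⟩
      rk x i' J + rk x l j' + Nx        ≡⟨ cong (λ e → e + rk x l j' + Nx) X-i'J ⟩
      rk w i' J + rk x l j' + Nx        ≡⟨ +-assoc (rk w i' J) _ _ ⟩
      rk w i' J + (rk x l j' + Nx)      ∎)
    where
    open ≡-Reasoning
    Nx : ℕ
    Nx = boxCount x l i' J j'
    solve : ∀ a b → a + (b + 1) ≡ a + b + 0 + 1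
    solve = solve-∀
    reorder : ∀ a b → a + b + 1 ≡ a + 1 + b
    reorder = solve-∀

  -- Either l > α and
  -- (l , j') ∈ R, or l ≤ α and the point (i₁ , x(i₁)) of x lies in the box.
  X-transfer : ∀ {l i' J j'} → l ≤ i' → α < i' → i' ≤ β → J ≤ x₁ → x₁ < j' → j' ≤ x₂ →
    InX (τ[ τ ] r) (i' , j') → InX τ (i' , J) → InX τ (l , J) → boxCount w l i' J j' ≡ 0 →
    InX (τ[ τ ] r) (l , j')
  X-transfer {l} {i'} {J} {j'} l≤i' α<i' i'≤β J≤x₁ x₁<j' j'≤x₂ Xt-i'j' X-i'J X-lJ empty =
    Xt-if-≤ (+-cancelʳ-≤ 1 _ _ (bound (α <? l)))
    where
    open ≤-Reasoning
    defect : rk w l j' + 1 ≡ rk x l j' + boxCount x l i' J j'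
    defect = corner-defect l≤i' (≤-trans J≤x₁ (<⇒≤ x₁<j')) (rect-in α<i' i'≤β x₁<j' j'≤x₂)
                           Xt-i'j' X-i'J X-lJ empty
    bound : Dec (α < l) → rk y l j' + 1 ≤ rk w l j' + 1
    bound (yes α<l) = begin
      rk y l j' + 1                 ≡⟨ cong (rk y l j' +_) (rect-in α<l (≤-trans l≤i' i'≤β) x₁<j' j'≤x₂) ⟨
      rk y l j' + R l j'            ≡⟨ rk-y+R l j' ⟩
      rk x l j'                     ≤⟨ m≤m+n _ _ ⟩
      rk x l j' + boxCount x l i' J j' ≡⟨ defect ⟨
      rk w l j' + 1                 ∎
    bound (no α≮l) = begin
      rk y l j' + 1                 ≤⟨ +-monoˡ-≤ 1 (y≤x l j') ⟩
      rk x l j' + 1                 ≤⟨ +-monoʳ-≤ (rk x l j') (box-point x i₁ (≮⇒≥ α≮l) α<i' J≤x₁ x₁<j') ⟩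
      rk x l j' + boxCount x l i' J j' ≡⟨ defect ⟨
      rk w l j' + 1                 ∎

lemma4p13 : ∀ {n} (τ : Pair n) (i₁ i₂ : Fin n) (r : InR τ i₁ i₂)
    (i j : ℕ) → InBox n (i , j) → InXc (τ[ τ ] r) (i , j)
    → (i' : ℕ) → upArrow (τ[ τ ] r) (i , j) ≡ (i' , j)
    → InXc (lowerPair τ r) (i' , j)
    → (j' : ℕ) → left τ (i , j) ≡ (i , j')
    → suc (toℕ (down τ ⟨$⟩ʳ i₁)) ≤ j'
    → UpMaximal τ (i' , j)
lemma4p13 τ i₁ i₂ r i j _ _ i' ↑p≡q q∈Xc j' ←p≡ x₁<j' = up-maximal τ i' j no-candidate
  where
  open Transposed τ r
  q∈R : (α < i' × i' ≤ β) × (x₁ < j × j ≤ x₂)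
  q∈R = Xc-lower⇒in-R q∈Xc
  α<i' : α < i'
  α<i' = proj₁ (proj₁ q∈R)
  i'≤β : i' ≤ β
  i'≤β = proj₂ (proj₁ q∈R)
  j'≡ : jMinus τ (i , j) ≡ j'
  j'≡ = cong proj₂ ←p≡
  j'<j : j' < j
  j'<j = subst (_< j) j'≡ (proj₁ (left-nearest τ i j (subst (0 <_) (sym j'≡) (≤-<-trans z≤n x₁<j'))))
  j'≤x₂ : j' ≤ x₂
  j'≤x₂ = ≤-trans (<⇒≤ j'<j) (proj₂ (proj₂ q∈R))
  -- ... so row i lies below R, as R avoids X_τ.
  i'≤i : i' ≤ i
  i'≤i = up-≤ (τ[ τ ] r) {i} {j} {i'} ↑p≡q
  β<i : β < i
  β<i = ≰⇒> λ i≤β → R-avoids-X (rect-in (<-≤-trans α<i' i'≤i) i≤β x₁<j' j'≤x₂)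
                               (subst (λ k → InX τ (i , k)) j'≡ (left-in-X τ i j))
  -- Hence p^←_{τ_t} = (i , j') as well, and i' is the least row with a
  -- candidate for p^↑_{τ_t} in column j'.
  q-least : (InX (τ[ τ ] r) (i' , j') × D≡0 w (i , j) (i' , j')) ×
            (∀ l → l < i' → ¬ (InX (τ[ τ ] r) (l , j') × D≡0 w (i , j) (l , j')))
  q-least = up-least (τ[ τ ] r) {i} {j} {i'} {j'} ↑p≡q (trans (left-below-R j β<i) j'≡) (≤-<-trans i'≤β β<i)
  J≤x₁ : jMinus τ (i' , j) ≤ x₁
  J≤x₁ = left-left-of-R α<i' i'≤β (proj₂ (proj₂ q∈R))
  -- A candidate for q^↑_τ would give an earlier candidate for p^↑_{τ_t}.
  no-candidate : ∀ l → l < i' → ¬ UpCandidate τ (i' , j) l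
  no-candidate l l<i' (X-lJ , D-lJ) = proj₂ q-least l l<i'
    ( X-transfer l≤i' α<i' i'≤β J≤x₁ x₁<j' j'≤x₂ (proj₁ (proj₁ q-least)) (left-in-X τ i' j) X-lJ
                 (D≡0-shrink w l≤i' J≤j' (<⇒≤ j'<j) D-lJ)
    , D≡0-compose w l≤i' i'≤i J≤j' (<⇒≤ j'<j) D-lJ (proj₂ (proj₁ q-least)))
    where
    l≤i' : l ≤ i'
    l≤i' = <⇒≤ l<i'
    J≤j' : jMinus τ (i' , j) ≤ j'
    J≤j' = ≤-trans J≤x₁ (<⇒≤ x₁<j')
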